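{- The universe $\mathbb{GS}$ of guaranteed Scoring games is natural; that is, the Normal-play mapping $\zeta:\mathbb{Np}\to\mathbb{GS}$ is an order-embedding: for all $G,H\in\mathbb{Np}$, $G\leqslant H$ in Normal-play if and only if $\zeta(G)\leqslant\zeta(H)$ in $\mathbb{GS}$.
   Context: Scoring games are built recursively: an atom $\emptyset^s$ ($s\in\mathbb{R}$) stands for an empty set of options carrying score $s$. Day-0 games are $\langle\emptyset^\ell\mid\emptyset^r\rangle$; a game born by day $i+1$ is $\langle\mathcal{G}\mid\mathcal{H}\rangle$ where each of $\mathcal{G},\mathcal{H}$ is a nonempty finite set of games born by day $i$ or a single atom. $\mathbb{S}$ is the set of all such games. A follower of $G$ is any game reachable from $G$ by a (possibly empty, not necessarily alternating) sequence of moves. Number $s$ means $\langle\emptyset^s\mid\emptyset^s\rangle$. Disjunctive sum: if $G=\langle\emptyset^{\ell_1}\mid\emptyset^{r_1}\rangle$, $H=\langle\emptyset^{\ell_2}\mid\emptyset^{r_2}\rangle$ then $G+H=\langle\emptyset^{\ell_1+\ell_2}\mid\emptyset^{r_1+r_2}\rangle$; otherwise the Left options of $G+H$ are all $G^L+H$ and $G+H^L$, and if neither $G$ nor $H$ has Left options the Left side is the atom $\emptyset^{\ell_1+\ell_2}$ (sum of the Left atoms); symmetrically for Right. Left-score: $Ls(G)=\ell$ if $G^{\mathcal L}=\emptyset^\ell$, else $\max_{G^L}Rs(G^L)$; Right-score: $Rs(G)=r$ if $G^{\mathcal R}=\emptyset^r$, else $\min_{G^R}Ls(G^R)$. In a universe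 $\mathcal{U}$ (a set of Scoring games closed under sums, options and conjugation), $G\geqslant H$ means $Ls(G+X)\geqslant Ls(H+X)$ and $Rs(G+X)\geqslant Rs(H+X)$ for all $X\in\mathcal U$. A game is atomic if at least one of $G^{\mathcal L},G^{\mathcal R}$ is an atom. An atomic game $G$ is guaranteed if $s\leqslant t$ for every atom $\emptyset^s$ occurring on Left's side (the Left atom of $G$, or any atom in a follower of a Left option of $G$) and every atom $\emptyset^t$ occurring on Right's side (the Right atom of $G$, or any atom in a follower of a Right option of $G$). A game is guaranteed if every atomic follower of it is guaranteed; $\mathbb{GS}$ is the set of guaranteed games (a universe containing all numbers). $\mathbb{Np}$ is the set of short Normal-play game forms, with $G\geqslant H$ iff Left wins $G-H$ playing second. The Normal-play mapping $\zeta(G)$ replaces every empty set of options in every follower of $G\in\mathbb{Np}$ by the atom $\emptyset^0$. -}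

module Defs where

open import Data.Nat using (ℕ)
open import Data.List using (List; []; _∷_)
open import Data.List.Relation.Unary.All using (All)
open import Data.List.Relation.Unary.Any using (Any)
open import Data.Product using (Σ; ∃; _×_; _,_)
open import Data.Sum using (_⊎_)
open import Relation.Binary.PropositionalEquality using (_≡_)
open import Relation.Nullary using (¬_; Dec; yes; no)
open import Function.Bundles using (_⇔_)

-- The real numbers, axiomatised as a Dedekind-complete ordered field.
-- (agda-stdlib has no reals; any model of this record is isomorphic to ℝ.)
-- Decidability of ≤ is classically true of ℝ and is included as an axiom.

record RealNumbers : Set₁ where
  infixl 6 _+_
  infixl 7 _*_
  infix 4 _≤_
  field
    Carrier : Set
    _+_ _*_ : Carrier → Carrier → Carrier
    -_      : Carrier → Carrier
    0# 1#   : Carrier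
    _≤_     : Carrier → Carrier → Set
    +-assoc    : ∀ x y z → (x + y) + z ≡ x + (y + z)
    +-comm     : ∀ x y → x + y ≡ y + x
    +-identity : ∀ x → x + 0# ≡ x
    +-inverse  : ∀ x → x + (- x) ≡ 0#
    *-assoc    : ∀ x y z → (x * y) * z ≡ x * (y * z)
    *-comm     : ∀ x y → x * y ≡ y * x
    *-identity : ∀ x → x * 1# ≡ x
    distrib    : ∀ x y z → x * (y + z) ≡ (x * y) + (x * z)
    0≢1        : ¬ (0# ≡ 1#)
    *-inverse  : ∀ x → ¬ (x ≡ 0#) → ∃ λ y → x * y ≡ 1#
    ≤-refl    : ∀ x → x ≤ x
    ≤-trans   : ∀ {x y z} → x ≤ y → y ≤ z → x ≤ z
    ≤-antisym : ∀ {x y} → x ≤ y → y ≤ x → x ≡ y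
    ≤-total   : ∀ x y → (x ≤ y) ⊎ (y ≤ x)
    _≤?_      : ∀ x y → Dec (x ≤ y)
    +-mono-≤  : ∀ {x y} z → x ≤ y → x + z ≤ y + z
    *-nonneg  : ∀ {x y} → 0# ≤ x → 0# ≤ y → 0# ≤ x * y
    lub : (P : Carrier → Set) → (∃ λ x → P x) → (∃ λ b → ∀ x → P x → x ≤ b) →
          ∃ λ u → (∀ x → P x → x ≤ u) × (∀ b → (∀ x → P x → x ≤ b) → u ≤ b)

data NP : Set where
  np : List NP → List NP → NP

mutual
  negNP : NP → NP
  negNP (np L R) = np (negList R) (negList L)

  negList : List NP → List NP
  negList []       = []
  negList (g ∷ gs) = negNP g ∷ negList gs

mutual
  _+NP_ : NP → NP → NP
  np GL GR +NP np HL HR = np (addLNP GL (np HL HR) ++' addRNP (np GL GR) HL)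
                             (addLNP GR (np HL HR) ++' addRNP (np GL GR) HR)

  addLNP : List NP → NP → List NP
  addLNP []       H = []
  addLNP (g ∷ gs) H = (g +NP H) ∷ addLNP gs H

  addRNP : NP → List NP → List NP
  addRNP G []       = []
  addRNP G (h ∷ hs) = (G +NP h) ∷ addRNP G hs

  _++'_ : List NP → List NP → List NP
  []       ++' ys = ys
  (x ∷ xs) ++' ys = x ∷ (xs ++' ys)

mutual
  data LeftWinsSecond : NP → Set where
    lws : ∀ {L R} → All LeftWinsFirst R → LeftWinsSecond (np L R)

  data LeftWinsFirst : NP → Set where
    lwf : ∀ {L R} → Any LeftWinsSecond L → LeftWinsFirst (np L R)

_≥NP_ : NP → NP → Set
G ≥NP H = LeftWinsSecond (G +NP negNP H)

_≤NP_ : NP → NP → Set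
G ≤NP H = H ≥NP G

module Scoring (ℝ : RealNumbers) where
  open RealNumbers ℝ

  mutual
    data Game : Set where
      ⟨_∣_⟩ : Side → Side → Game

    data Side : Set where
      atom : Carrier → Side
      opts : Opts → Side

    data Opts : Set where
      [_]  : Game → Opts
      _∷_  : Game → Opts → Opts

  data _∈O_ (g : Game) : Opts → Set where
    here₁ : g ∈O [ g ]
    here  : ∀ {os} → g ∈O (g ∷ os)
    there : ∀ {h os} → g ∈O os → g ∈O (h ∷ os)

  _++O_ : Opts → Opts → Opts
  [ g ]    ++O ys = g ∷ ys
  (g ∷ xs) ++O ys = g ∷ (xs ++O ys)

  mutual
    _⊕_ : Game → Game → Game
    ⟨ gl ∣ gr ⟩ ⊕ ⟨ hl ∣ hr ⟩ =
      ⟨ sumSide gl hl ⟨ gl ∣ gr ⟩ ⟨ hl ∣ hr ⟩ ∣ sumSide gr hr ⟨ gl ∣ gr ⟩ ⟨ hl ∣ hr ⟩ ⟩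

    sumSide : Side → Side → Game → Game → Side
    sumSide (atom a) (atom b) G H = atom (a + b)
    sumSide (atom a) (opts hs) G H = opts (addR G hs)
    sumSide (opts gs) (atom b) G H = opts (addL gs H)
    sumSide (opts gs) (opts hs) G H = opts (addL gs H ++O addR G hs)

    addL : Opts → Game → Opts
    addL [ g ]    H = [ g ⊕ H ]
    addL (g ∷ gs) H = (g ⊕ H) ∷ addL gs H

    addR : Game → Opts → Opts
    addR G [ h ]    = [ G ⊕ h ]
    addR G (h ∷ hs) = (G ⊕ h) ∷ addR G hs

  max : Carrier → Carrier → Carrier
  max x y with x ≤? y
  ... | yes _ = y
  ... | no  _ = x

  min : Carrier → Carrier → Carrier
  min x y with x ≤? y
  ... | yes _ = x
  ... | no  _ = y

  mutual
    Ls : Game → Carrier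
    Ls ⟨ atom l  ∣ _ ⟩ = l
    Ls ⟨ opts os ∣ _ ⟩ = maxRs os

    Rs : Game → Carrier
    Rs ⟨ _ ∣ atom r  ⟩ = r
    Rs ⟨ _ ∣ opts os ⟩ = minLs os

    maxRs : Opts → Carrier
    maxRs [ g ]    = Rs g
    maxRs (g ∷ gs) = max (Rs g) (maxRs gs)

    minLs : Opts → Carrier
    minLs [ g ]    = Ls g
    minLs (g ∷ gs) = min (Ls g) (minLs gs)

  data Follower : Game → Game → Set where
    self   : ∀ {G} → Follower G G
    viaL   : ∀ {F g os r} → g ∈O os → Follower F g → Follower F ⟨ opts os ∣ r ⟩
    viaR   : ∀ {F g os l} → g ∈O os → Follower F g → Follower F ⟨ l ∣ opts os ⟩

  data AtomOf (G : Game) (s : Carrier) : Set where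
    leftAtom  : ∀ {F r} → Follower F G → F ≡ ⟨ atom s ∣ r ⟩ → AtomOf G s
    rightAtom : ∀ {F l} → Follower F G → F ≡ ⟨ l ∣ atom s ⟩ → AtomOf G s

  data LeftSideAtom : Game → Carrier → Set where
    latom : ∀ {s r} → LeftSideAtom ⟨ atom s ∣ r ⟩ s
    lopt  : ∀ {s g os r} → g ∈O os → AtomOf g s → LeftSideAtom ⟨ opts os ∣ r ⟩ s

  data RightSideAtom : Game → Carrier → Set where
    ratom : ∀ {t l} → RightSideAtom ⟨ l ∣ atom t ⟩ t
    ropt  : ∀ {t g os l} → g ∈O os → AtomOf g t → RightSideAtom ⟨ l ∣ opts os ⟩ t

  Atomic : Game → Set
  Atomic G = (∃ λ s → ∃ λ r → G ≡ ⟨ atom s ∣ r ⟩) ⊎ (∃ λ t → ∃ λ l → G ≡ ⟨ l ∣ atom t ⟩)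

  AtomicGuaranteed : Game → Set
  AtomicGuaranteed G = ∀ s t → LeftSideAtom G s → RightSideAtom G t → s ≤ t

  Guaranteed : Game → Set
  Guaranteed G = ∀ F → Follower F G → Atomic F → AtomicGuaranteed F

  _≤GS_ : Game → Game → Set
  G ≤GS H = ∀ X → Guaranteed X → (Ls (G ⊕ X) ≤ Ls (H ⊕ X)) × (Rs (G ⊕ X) ≤ Rs (H ⊕ X))

  mutual
    ζ : NP → Game
    ζ (np L R) = ⟨ ζside L ∣ ζside R ⟩

    ζside : List NP → Side
    ζside []       = atom 0#
    ζside (g ∷ gs) = opts (ζopts g gs)

    ζopts : NP → List NP → Opts
    ζopts g []        = [ ζ g ]
    ζopts g (h ∷ hs)  = ζ g ∷ ζopts h hs

-- Order preservation (forward) follows Left's Normal-play strategy: if G ≤ H and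
-- X is guaranteed, every move in ζ G + X is answered in ζ H + X, by induction on
-- G, H and X.  When a sum ends in an atom of X, the key fact is that every score
-- of a game is one of its atoms, and in a guaranteed game the Left atom is below
-- (the Right atom above) all atoms.
--
-- Order reflection (backward) uses the embedding ζ with Left atoms a < b Right
-- atoms.  In ζ P + w(K) a score of at least b means Right got stuck, i.e. Left
-- wins P + K; Tweedledum shows Right scores b in ζ G + w(-G); and w(-G) is
-- guaranteed, so ζ G ≤ ζ H forces Right's score b in ζ H + w(-G) as well.
module Submission where

open import Defs
open import Function.Bundles using (_⇔_; mk⇔)
open import Data.List using (List; []; _∷_; _++_; map)
open import Data.List.Properties using (++-identityʳ)
open import Data.List.Membership.Propositional using (_∈_; find; lose)
open import Data.List.Membership.Propositional.Properties
  using (∈-map⁺; ∈-map⁻; ∈-++⁺ˡ; ∈-++⁺ʳ; ∈-++⁻)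
import Data.List.Relation.Unary.All as All
open import Data.List.Relation.Unary.Any using (here; there)
open import Data.Product using (Σ; ∃; ∃₂; _×_; _,_; proj₁; proj₂)
open import Data.Sum using (_⊎_; inj₁; inj₂)
open import Data.Empty using (⊥-elim)
open import Induction.WellFounded using (Acc; acc)
open import Relation.Binary.Construct.Closure.Transitive
  using (TransClosure; [_]; _∷_; accessible)
open import Relation.Binary.PropositionalEquality
  using (_≡_; refl; sym; trans; cong; cong₂; subst)
open import Relation.Nullary using (¬_; yes; no)

data Player : Set where
  left right : Player

opponent : Player → Player
opponent left  = right
opponent right = left

∈-map++map⁻ : ∀ {A B C : Set} (f : A → C) (g : B → C) xs ys {x} →
  x ∈ map f xs ++ map g ys →
  (∃ λ y → y ∈ xs × x ≡ f y) ⊎ (∃ λ y → y ∈ ys × x ≡ g y)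
∈-map++map⁻ f g xs ys m with ∈-++⁻ (map f xs) m
... | inj₁ m′ = inj₁ (∈-map⁻ f m′)
... | inj₂ m′ = inj₂ (∈-map⁻ g m′)

npOptions : Player → NP → List NP
npOptions left  (np L R) = L
npOptions right (np L R) = R

++'≡++ : ∀ xs ys → xs ++' ys ≡ xs ++ ys
++'≡++ []       ys = refl
++'≡++ (x ∷ xs) ys = cong (x ∷_) (++'≡++ xs ys)

addLNP≡map : ∀ gs H → addLNP gs H ≡ map (_+NP H) gs
addLNP≡map []       H = refl
addLNP≡map (g ∷ gs) H = cong (g +NP H ∷_) (addLNP≡map gs H)

addRNP≡map : ∀ G hs → addRNP G hs ≡ map (G +NP_) hs
addRNP≡map G []       = refl
addRNP≡map G (h ∷ hs) = cong (G +NP h ∷_) (addRNP≡map G hs)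

negList≡map : ∀ L → negList L ≡ map negNP L
negList≡map []       = refl
negList≡map (g ∷ gs) = cong (negNP g ∷_) (negList≡map gs)

npOptions-+NP : ∀ q G H →
  npOptions q (G +NP H) ≡ map (_+NP H) (npOptions q G) ++ map (G +NP_) (npOptions q H)
npOptions-+NP left (np GL GR) (np HL HR) = trans (++'≡++ (addLNP GL (np HL HR)) _)
  (cong₂ _++_ (addLNP≡map GL (np HL HR)) (addRNP≡map (np GL GR) HL))
npOptions-+NP right (np GL GR) (np HL HR) = trans (++'≡++ (addLNP GR (np HL HR)) _)
  (cong₂ _++_ (addLNP≡map GR (np HL HR)) (addRNP≡map (np GL GR) HR))

npOptions-neg : ∀ q G → npOptions q (negNP G) ≡ map negNP (npOptions (opponent q) G)
npOptions-neg left  (np L R) = negList≡map R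
npOptions-neg right (np L R) = negList≡map L

+NP-option⁻ : ∀ q G H {x} → x ∈ npOptions q (G +NP H) →
  (∃ λ g → g ∈ npOptions q G × x ≡ g +NP H) ⊎ (∃ λ h → h ∈ npOptions q H × x ≡ G +NP h)
+NP-option⁻ q G H m =
  ∈-map++map⁻ (_+NP H) (G +NP_) (npOptions q G) _ (subst (_ ∈_) (npOptions-+NP q G H) m)

+NP-optionˡ : ∀ q G H {g} → g ∈ npOptions q G → g +NP H ∈ npOptions q (G +NP H)
+NP-optionˡ q G H m =
  subst (_ ∈_) (sym (npOptions-+NP q G H)) (∈-++⁺ˡ (∈-map⁺ (_+NP H) m))

+NP-optionʳ : ∀ q G H {h} → h ∈ npOptions q H → G +NP h ∈ npOptions q (G +NP H)
+NP-optionʳ q G H m =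
  subst (_ ∈_) (sym (npOptions-+NP q G H)) (∈-++⁺ʳ _ (∈-map⁺ (G +NP_) m))

neg-option⁻ : ∀ q G {x} → x ∈ npOptions q (negNP G) →
  ∃ λ g → g ∈ npOptions (opponent q) G × x ≡ negNP g
neg-option⁻ q G m = ∈-map⁻ negNP (subst (_ ∈_) (npOptions-neg q G) m)

neg-option : ∀ q G {g} → g ∈ npOptions (opponent q) G → negNP g ∈ npOptions q (negNP G)
neg-option q G m = subst (_ ∈_) (sym (npOptions-neg q G)) (∈-map⁺ negNP m)

leftWinsFirst⁻ : ∀ {G} → LeftWinsFirst G → ∃ λ g → g ∈ npOptions left G × LeftWinsSecond g
leftWinsFirst⁻ (lwf wins) = find wins

leftWinsFirst⁺ : ∀ {G g} → g ∈ npOptions left G → LeftWinsSecond g → LeftWinsFirst G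
leftWinsFirst⁺ {np L R} g∈ win = lwf (lose g∈ win)

leftWinsSecond⁻ : ∀ {G g} → LeftWinsSecond G → g ∈ npOptions right G → LeftWinsFirst g
leftWinsSecond⁻ (lws wins) = All.lookup wins

leftWinsSecond⁺ : ∀ {G} → (∀ {g} → g ∈ npOptions right G → LeftWinsFirst g) → LeftWinsSecond G
leftWinsSecond⁺ {np L R} wins = lws (All.tabulate wins)

-- If G ≤ H, a Left move g of G is matched by a Left move h' of H with g ≤ h',
-- or reversed by a Right move g' of g with g' ≤ H: these are Left's possible
-- winning replies x after Right moves from H - G to H - g.
≤NP-leftOption : ∀ {G H g} → G ≤NP H → g ∈ npOptions left G →
  (∃ λ h' → h' ∈ npOptions left H × g ≤NP h') ⊎ (∃ λ g' → g' ∈ npOptions right g × g' ≤NP H)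
≤NP-leftOption {G} {H} {g} G≤H g∈
  with leftWinsFirst⁻ (leftWinsSecond⁻ G≤H (+NP-optionʳ right H (negNP G) (neg-option right G g∈)))
... | x , x∈ , win with +NP-option⁻ left H (negNP g) x∈
...   | inj₁ (h' , h'∈ , refl) = inj₁ (h' , h'∈ , win)
...   | inj₂ (y , y∈ , refl) with neg-option⁻ left g y∈
...     | g' , g'∈ , refl = inj₂ (g' , g'∈ , win)

≤NP-rightOption : ∀ {G H h} → G ≤NP H → h ∈ npOptions right H →
  (∃ λ h' → h' ∈ npOptions left h × G ≤NP h') ⊎ (∃ λ g' → g' ∈ npOptions right G × g' ≤NP h)
≤NP-rightOption {G} {H} {h} G≤H h∈
  with leftWinsFirst⁻ (leftWinsSecond⁻ G≤H (+NP-optionˡ right H (negNP G) h∈))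
... | x , x∈ , win with +NP-option⁻ left h (negNP G) x∈
...   | inj₁ (h' , h'∈ , refl) = inj₁ (h' , h'∈ , win)
...   | inj₂ (y , y∈ , refl) with neg-option⁻ left G y∈
...     | g' , g'∈ , refl = inj₂ (g' , g'∈ , win)

-- p ⊏ P : p is an option of P.  It is well founded, hence so is its transitive
-- closure ⊏⁺, which is needed where a reply is an option of an option.
_⊏_ : NP → NP → Set
p ⊏ P = Σ Player λ q → p ∈ npOptions q P

_⊏⁺_ : NP → NP → Set
_⊏⁺_ = TransClosure _⊏_

mutual
  ⊏-acc : ∀ P → Acc _⊏_ P
  ⊏-acc (np L R) = acc λ where
    (left  , m) → member-acc L m
    (right , m) → member-acc R m

  member-acc : ∀ L {p} → p ∈ L → Acc _⊏_ p
  member-acc (x ∷ xs) (here refl) = ⊏-acc x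
  member-acc (x ∷ xs) (there m)   = member-acc xs m

⊏⁺-acc : ∀ P → Acc _⊏⁺_ P
⊏⁺-acc P = accessible _⊏_ (⊏-acc P)

module _ (ℝ : RealNumbers) where
  open RealNumbers ℝ
  open Scoring ℝ

  0+ : ∀ x → 0# + x ≡ x
  0+ x = trans (+-comm 0# x) (+-identity x)

  max-selective : ∀ x y → max x y ≡ x ⊎ max x y ≡ y
  max-selective x y with x ≤? y
  ... | yes _ = inj₂ refl
  ... | no  _ = inj₁ refl

  max-upperˡ : ∀ x y → x ≤ max x y
  max-upperˡ x y with x ≤? y
  ... | yes x≤y = x≤y
  ... | no  _   = ≤-refl x

  max-upperʳ : ∀ x y → y ≤ max x y
  max-upperʳ x y with x ≤? y | ≤-total x y
  ... | yes _   | _        = ≤-refl y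
  ... | no  x≰y | inj₁ x≤y = ⊥-elim (x≰y x≤y)
  ... | no  _   | inj₂ y≤x = y≤x

  min-selective : ∀ x y → min x y ≡ x ⊎ min x y ≡ y
  min-selective x y with x ≤? y
  ... | yes _ = inj₁ refl
  ... | no  _ = inj₂ refl

  min-lowerˡ : ∀ x y → min x y ≤ x
  min-lowerˡ x y with x ≤? y | ≤-total x y
  ... | yes _   | _        = ≤-refl x
  ... | no  x≰y | inj₁ x≤y = ⊥-elim (x≰y x≤y)
  ... | no  _   | inj₂ y≤x = y≤x

  min-lowerʳ : ∀ x y → min x y ≤ y
  min-lowerʳ x y with x ≤? y
  ... | yes x≤y = x≤y
  ... | no  _   = ≤-refl y

  toList : Opts → List Game
  toList [ g ]    = g ∷ []
  toList (g ∷ os) = g ∷ toList os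

  ∈O⇒∈ : ∀ {g} os → g ∈O os → g ∈ toList os
  ∈O⇒∈ [ g ]    here₁     = here refl
  ∈O⇒∈ (g ∷ os) here      = here refl
  ∈O⇒∈ (g ∷ os) (there m) = there (∈O⇒∈ os m)

  ∈⇒∈O : ∀ {g} os → g ∈ toList os → g ∈O os
  ∈⇒∈O [ g ]    (here refl) = here₁
  ∈⇒∈O (g ∷ os) (here refl) = here
  ∈⇒∈O (g ∷ os) (there m)   = there (∈⇒∈O os m)

  sideList : Side → List Game
  sideList (atom _)  = []
  sideList (opts os) = toList os

  side : Player → Game → Side
  side left  ⟨ l ∣ _ ⟩ = l
  side right ⟨ _ ∣ r ⟩ = r

  options : Player → Game → List Game
  options p G = sideList (side p G)

  toList-++O : ∀ xs ys → toList (xs ++O ys) ≡ toList xs ++ toList ys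
  toList-++O [ g ]    ys = refl
  toList-++O (g ∷ xs) ys = cong (g ∷_) (toList-++O xs ys)

  toList-addL : ∀ gs H → toList (addL gs H) ≡ map (_⊕ H) (toList gs)
  toList-addL [ g ]    H = refl
  toList-addL (g ∷ gs) H = cong (g ⊕ H ∷_) (toList-addL gs H)

  toList-addR : ∀ G hs → toList (addR G hs) ≡ map (G ⊕_) (toList hs)
  toList-addR G [ h ]    = refl
  toList-addR G (h ∷ hs) = cong (G ⊕ h ∷_) (toList-addR G hs)

  side-⊕ : ∀ p A B → side p (A ⊕ B) ≡ sumSide (side p A) (side p B) A B
  side-⊕ left  ⟨ _ ∣ _ ⟩ ⟨ _ ∣ _ ⟩ = refl
  side-⊕ right ⟨ _ ∣ _ ⟩ ⟨ _ ∣ _ ⟩ = refl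

  sideList-sumSide : ∀ g h A B →
    sideList (sumSide g h A B) ≡ map (_⊕ B) (sideList g) ++ map (A ⊕_) (sideList h)
  sideList-sumSide (atom _)  (atom _)  A B = refl
  sideList-sumSide (atom _)  (opts hs) A B = toList-addR A hs
  sideList-sumSide (opts gs) (atom _)  A B =
    trans (toList-addL gs B) (sym (++-identityʳ (map (_⊕ B) (toList gs))))
  sideList-sumSide (opts gs) (opts hs) A B = trans (toList-++O (addL gs B) (addR A hs))
    (cong₂ _++_ (toList-addL gs B) (toList-addR A hs))

  options-⊕ : ∀ p A B →
    options p (A ⊕ B) ≡ map (_⊕ B) (options p A) ++ map (A ⊕_) (options p B)
  options-⊕ p A B =
    trans (cong sideList (side-⊕ p A B)) (sideList-sumSide (side p A) (side p B) A B)

  sumSide-atom : ∀ g h A B {s} → sumSide g h A B ≡ atom s →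
    ∃₂ λ sa sb → g ≡ atom sa × h ≡ atom sb × s ≡ sa + sb
  sumSide-atom (atom sa) (atom sb) A B refl = sa , sb , refl , refl , refl
  sumSide-atom (atom _)  (opts _)  A B ()
  sumSide-atom (opts _)  (atom _)  A B ()
  sumSide-atom (opts _)  (opts _)  A B ()

  ⊕-atom : ∀ p A B {s} → side p (A ⊕ B) ≡ atom s →
    ∃₂ λ sa sb → side p A ≡ atom sa × side p B ≡ atom sb × s ≡ sa + sb
  ⊕-atom p A B e = sumSide-atom (side p A) (side p B) A B (trans (sym (side-⊕ p A B)) e)

  ⊕-option⁻ : ∀ p A B {k} → k ∈ options p (A ⊕ B) →
    (∃ λ a → a ∈ options p A × k ≡ a ⊕ B) ⊎ (∃ λ b → b ∈ options p B × k ≡ A ⊕ b)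
  ⊕-option⁻ p A B m =
    ∈-map++map⁻ (_⊕ B) (A ⊕_) (options p A) _ (subst (_ ∈_) (options-⊕ p A B) m)

  ⊕-optionˡ : ∀ p {a} A B → a ∈ options p A → a ⊕ B ∈ options p (A ⊕ B)
  ⊕-optionˡ p A B m = subst (_ ∈_) (sym (options-⊕ p A B)) (∈-++⁺ˡ (∈-map⁺ (_⊕ B) m))

  ⊕-optionʳ : ∀ p A {b} B → b ∈ options p B → A ⊕ b ∈ options p (A ⊕ B)
  ⊕-optionʳ p A B m = subst (_ ∈_) (sym (options-⊕ p A B)) (∈-++⁺ʳ _ (∈-map⁺ (A ⊕_) m))

  _◁_ : Game → Game → Set
  k ◁ G = Σ Player λ p → k ∈ options p G

  mutual
    ◁-acc : ∀ G → Acc _◁_ G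
    ◁-acc ⟨ l ∣ r ⟩ = acc λ where
      (left  , m) → side-acc l m
      (right , m) → side-acc r m

    side-acc : ∀ s {k} → k ∈ sideList s → Acc _◁_ k
    side-acc (atom _)  ()
    side-acc (opts os) m = opts-acc os m

    opts-acc : ∀ os {k} → k ∈ toList os → Acc _◁_ k
    opts-acc [ g ]    (here refl) = ◁-acc g
    opts-acc (g ∷ os) (here refl) = ◁-acc g
    opts-acc (g ∷ os) (there m)   = opts-acc os m

  maxRs-upper : ∀ os {k} → k ∈ toList os → Rs k ≤ maxRs os
  maxRs-upper [ g ]    (here refl) = ≤-refl (Rs g)
  maxRs-upper (g ∷ os) (here refl) = max-upperˡ (Rs g) (maxRs os)
  maxRs-upper (g ∷ os) (there m)   =
    ≤-trans (maxRs-upper os m) (max-upperʳ (Rs g) (maxRs os))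

  maxRs-attained : ∀ os → ∃ λ k → k ∈ toList os × maxRs os ≡ Rs k
  maxRs-attained [ g ] = g , here refl , refl
  maxRs-attained (g ∷ os) with max-selective (Rs g) (maxRs os)
  ... | inj₁ e = g , here refl , e
  ... | inj₂ e = let k , k∈ , e' = maxRs-attained os in k , there k∈ , trans e e'

  minLs-lower : ∀ os {k} → k ∈ toList os → minLs os ≤ Ls k
  minLs-lower [ g ]    (here refl) = ≤-refl (Ls g)
  minLs-lower (g ∷ os) (here refl) = min-lowerˡ (Ls g) (minLs os)
  minLs-lower (g ∷ os) (there m)   =
    ≤-trans (min-lowerʳ (Ls g) (minLs os)) (minLs-lower os m)

  minLs-attained : ∀ os → ∃ λ k → k ∈ toList os × minLs os ≡ Ls k
  minLs-attained [ g ] = g , here refl , refl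
  minLs-attained (g ∷ os) with min-selective (Ls g) (minLs os)
  ... | inj₁ e = g , here refl , e
  ... | inj₂ e = let k , k∈ , e' = minLs-attained os in k , there k∈ , trans e e'

  Ls-cases : ∀ G → side left G ≡ atom (Ls G) ⊎ ∃ λ k → k ∈ options left G × Ls G ≡ Rs k
  Ls-cases ⟨ atom _  ∣ _ ⟩ = inj₁ refl
  Ls-cases ⟨ opts os ∣ _ ⟩ = inj₂ (maxRs-attained os)

  Rs-cases : ∀ G → side right G ≡ atom (Rs G) ⊎ ∃ λ k → k ∈ options right G × Rs G ≡ Ls k
  Rs-cases ⟨ _ ∣ atom _  ⟩ = inj₁ refl
  Rs-cases ⟨ _ ∣ opts os ⟩ = inj₂ (minLs-attained os)

  Ls-upper : ∀ G {k} → k ∈ options left G → Rs k ≤ Ls G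
  Ls-upper ⟨ atom _  ∣ _ ⟩ ()
  Ls-upper ⟨ opts os ∣ _ ⟩ m = maxRs-upper os m

  Rs-lower : ∀ G {k} → k ∈ options right G → Rs G ≤ Ls k
  Rs-lower ⟨ _ ∣ atom _  ⟩ ()
  Rs-lower ⟨ _ ∣ opts os ⟩ m = minLs-lower os m

  Ls-≤ : ∀ G {c} → (∀ {l} → side left G ≡ atom l → l ≤ c) →
         (∀ {k} → k ∈ options left G → Rs k ≤ c) → Ls G ≤ c
  Ls-≤ G {c} atom≤ option≤ with Ls-cases G
  ... | inj₁ e           = atom≤ e
  ... | inj₂ (k , m , e) = subst (_≤ c) (sym e) (option≤ m)

  ≤-Rs : ∀ G {c} → (∀ {r} → side right G ≡ atom r → c ≤ r) →
         (∀ {k} → k ∈ options right G → c ≤ Ls k) → c ≤ Rs G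
  ≤-Rs G {c} ≤atom ≤option with Rs-cases G
  ... | inj₁ e           = ≤atom e
  ... | inj₂ (k , m , e) = subst (c ≤_) (sym e) (≤option m)

  follower-step : ∀ p {F k G} → k ∈ options p G → Follower F k → Follower F G
  follower-step left  {G = ⟨ atom _  ∣ _ ⟩} () f
  follower-step right {G = ⟨ _ ∣ atom _  ⟩} () f
  follower-step left  {G = ⟨ opts os ∣ _ ⟩} m f = viaL (∈⇒∈O os m) f
  follower-step right {G = ⟨ _ ∣ opts os ⟩} m f = viaR (∈⇒∈O os m) f

  follower-trans : ∀ {F K G} → Follower F K → Follower K G → Follower F G
  follower-trans f self        = f
  follower-trans f (viaL m f') = viaL m (follower-trans f f')
  follower-trans f (viaR m f') = viaR m (follower-trans f f')

  follower-closed : (Q : Game → Set) → (∀ p {k G} → k ∈ options p G → Q G → Q k) →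
                    ∀ {F G} → Follower F G → Q G → Q F
  follower-closed Q step self                 qG = qG
  follower-closed Q step (viaL {os = os} m f) qG =
    follower-closed Q step f (step left (∈O⇒∈ os m) qG)
  follower-closed Q step (viaR {os = os} m f) qG =
    follower-closed Q step f (step right (∈O⇒∈ os m) qG)

  SumOfFollowers : Game → Game → Game → Set
  SumOfFollowers A B F = ∃₂ λ A' B' → Follower A' A × Follower B' B × F ≡ A' ⊕ B'

  followers-⊕ : ∀ A B {F} → Follower F (A ⊕ B) → SumOfFollowers A B F
  followers-⊕ A B f = follower-closed (SumOfFollowers A B) step f (A , B , self , self , refl)
    where
    step : ∀ p {k G} → k ∈ options p G → SumOfFollowers A B G → SumOfFollowers A B k
    step p m (A' , B' , fA , fB , refl) with ⊕-option⁻ p A' B' m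
    ... | inj₁ (a , a∈ , refl) = a , B' , follower-trans (follower-step p a∈ self) fA , fB , refl
    ... | inj₂ (b , b∈ , refl) = A' , b , fA , follower-trans (follower-step p b∈ self) fB , refl

  atom-intro : ∀ p {F G s} → Follower F G → side p F ≡ atom s → AtomOf G s
  atom-intro left  {F = ⟨ _ ∣ _ ⟩} f refl = leftAtom f refl
  atom-intro right {F = ⟨ _ ∣ _ ⟩} f refl = rightAtom f refl

  atom-elim : ∀ {G s} → AtomOf G s → ∃₂ λ p F → Follower F G × side p F ≡ atom s
  atom-elim (leftAtom  f refl) = left  , _ , f , refl
  atom-elim (rightAtom f refl) = right , _ , f , refl

  atom-option : ∀ p {k G s} → k ∈ options p G → AtomOf k s → AtomOf G s
  atom-option p m at =
    let q , F , f , e = atom-elim at in atom-intro q (follower-step p m f) e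

  atoms-⊕ : ∀ A B {s} → AtomOf (A ⊕ B) s →
    ∃₂ λ sa sb → AtomOf A sa × AtomOf B sb × s ≡ sa + sb
  atoms-⊕ A B at with atom-elim at
  ... | p , F , f , e with followers-⊕ A B f
  ...   | A' , B' , fA , fB , refl with ⊕-atom p A' B' e
  ...     | sa , sb , ea , eb , refl = sa , sb , atom-intro p fA ea , atom-intro p fB eb , refl

  mutual
    Ls-atom : ∀ {G} → Acc _◁_ G → AtomOf G (Ls G)
    Ls-atom {G} (acc rs) with Ls-cases G
    ... | inj₁ e           = atom-intro left self e
    ... | inj₂ (k , m , e) =
      subst (AtomOf G) (sym e) (atom-option left m (Rs-atom (rs (left , m))))

    Rs-atom : ∀ {G} → Acc _◁_ G → AtomOf G (Rs G)
    Rs-atom {G} (acc rs) with Rs-cases G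
    ... | inj₁ e           = atom-intro right self e
    ... | inj₂ (k , m , e) =
      subst (AtomOf G) (sym e) (atom-option right m (Ls-atom (rs (right , m))))

  guaranteed-option : ∀ p {k X} → Guaranteed X → k ∈ options p X → Guaranteed k
  guaranteed-option p gX m F f = gX F (follower-step p m f)

  -- In a guaranteed game with Left atom l, every atom is at least l:
  -- the other atoms all lie on Right's side.
  leftAtom-least : ∀ {X l s} → Guaranteed X → side left X ≡ atom l → AtomOf X s → l ≤ s
  leftAtom-least {⟨ atom l ∣ r ⟩} gX refl (leftAtom self refl) = ≤-refl l
  leftAtom-least {⟨ atom l ∣ r ⟩} gX refl (leftAtom (viaR m f) e) =
    gX _ self (inj₁ (l , r , refl)) l _ latom (ropt m (leftAtom f e))
  leftAtom-least {⟨ atom l ∣ r ⟩} gX refl (rightAtom self refl) =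
    gX _ self (inj₁ (l , r , refl)) l _ latom ratom
  leftAtom-least {⟨ atom l ∣ r ⟩} gX refl (rightAtom (viaR m f) e) =
    gX _ self (inj₁ (l , r , refl)) l _ latom (ropt m (rightAtom f e))

  rightAtom-greatest : ∀ {X r s} → Guaranteed X → side right X ≡ atom r → AtomOf X s → s ≤ r
  rightAtom-greatest {⟨ l ∣ atom r ⟩} gX refl (rightAtom self refl) = ≤-refl r
  rightAtom-greatest {⟨ l ∣ atom r ⟩} gX refl (rightAtom (viaL m f) e) =
    gX _ self (inj₂ (r , l , refl)) _ r (lopt m (rightAtom f e)) ratom
  rightAtom-greatest {⟨ l ∣ atom r ⟩} gX refl (leftAtom self refl) =
    gX _ self (inj₂ (r , l , refl)) _ r latom ratom
  rightAtom-greatest {⟨ l ∣ atom r ⟩} gX refl (leftAtom (viaL m f) e) =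
    gX _ self (inj₂ (r , l , refl)) _ r (lopt m (leftAtom f e)) ratom

  leftSideAtom-atom : ∀ {G s} → LeftSideAtom G s → AtomOf G s
  leftSideAtom-atom latom      = leftAtom self refl
  leftSideAtom-atom (lopt m a) = atom-option left (∈O⇒∈ _ m) a

  rightSideAtom-atom : ∀ {G s} → RightSideAtom G s → AtomOf G s
  rightSideAtom-atom ratom      = rightAtom self refl
  rightSideAtom-atom (ropt m a) = atom-option right (∈O⇒∈ _ m) a

  -- The Normal-play mapping with Left atoms a and Right atoms b (ζ is the case a = b = 0).
  module Embedding (a b : Carrier) where
    mutual
      ζ[_] : NP → Game
      ζ[ np L R ] = ⟨ embedSide a L ∣ embedSide b R ⟩

      embedSide : Carrier → List NP → Side
      embedSide c []       = atom c
      embedSide c (g ∷ gs) = opts (embedOpts g gs)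

      embedOpts : NP → List NP → Opts
      embedOpts g []       = [ ζ[ g ] ]
      embedOpts g (h ∷ hs) = ζ[ g ] ∷ embedOpts h hs

    atomValue : Player → Carrier
    atomValue left  = a
    atomValue right = b

    toList-embedOpts : ∀ g gs → toList (embedOpts g gs) ≡ map ζ[_] (g ∷ gs)
    toList-embedOpts g []       = refl
    toList-embedOpts g (h ∷ hs) = cong (ζ[ g ] ∷_) (toList-embedOpts h hs)

    sideList-embedSide : ∀ c L → sideList (embedSide c L) ≡ map ζ[_] L
    sideList-embedSide c []       = refl
    sideList-embedSide c (g ∷ gs) = toList-embedOpts g gs

    options-ζ : ∀ p P → options p ζ[ P ] ≡ map ζ[_] (npOptions p P)
    options-ζ left  (np L R) = sideList-embedSide a L
    options-ζ right (np L R) = sideList-embedSide b R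

    ζ-option⁻ : ∀ p P {k} → k ∈ options p ζ[ P ] →
      ∃ λ P' → P' ∈ npOptions p P × k ≡ ζ[ P' ]
    ζ-option⁻ p P m = ∈-map⁻ ζ[_] (subst (_ ∈_) (options-ζ p P) m)

    ζ-option : ∀ p P {P'} → P' ∈ npOptions p P → ζ[ P' ] ∈ options p ζ[ P ]
    ζ-option p P m = subst (_ ∈_) (sym (options-ζ p P)) (∈-map⁺ ζ[_] m)

    ζ⊕-option⁻ : ∀ p P X {k} → k ∈ options p (ζ[ P ] ⊕ X) →
      (∃ λ P' → P' ∈ npOptions p P × k ≡ ζ[ P' ] ⊕ X) ⊎
      (∃ λ x → x ∈ options p X × k ≡ ζ[ P ] ⊕ x)
    ζ⊕-option⁻ p P X m with ⊕-option⁻ p ζ[ P ] X m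
    ... | inj₂ x-move            = inj₂ x-move
    ... | inj₁ (_ , m' , refl) with ζ-option⁻ p P m'
    ...   | P' , P'∈ , refl = inj₁ (P' , P'∈ , refl)

    side-ζ-atom : ∀ p P {s} → side p ζ[ P ] ≡ atom s → s ≡ atomValue p
    side-ζ-atom left  (np [] R) refl = refl
    side-ζ-atom right (np L []) refl = refl

    InImage : Game → Set
    InImage G = ∃ λ P → G ≡ ζ[ P ]

    follower-InImage : ∀ {F G} → Follower F G → InImage G → InImage F
    follower-InImage = follower-closed InImage step
      where
      step : ∀ p {k G} → k ∈ options p G → InImage G → InImage k
      step p m (P , refl) = let P' , _ , e = ζ-option⁻ p P m in P' , e

    atom-InImage : ∀ {G s} → InImage G → AtomOf G s → ∃ λ p → s ≡ atomValue p
    atom-InImage im at with atom-elim at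
    ... | p , F , f , e with follower-InImage f im
    ...   | P , refl = p , side-ζ-atom p P e

    ζ-guaranteed : a ≤ b → ∀ P → Guaranteed ζ[ P ]
    ζ-guaranteed a≤b P F f atomic s t sL tR with follower-InImage f (P , refl)
    ... | P' , F≡ζ = atomic-guaranteed atomic sL tR
      where
      atom-of-F : ∀ {u} → AtomOf F u → ∃ λ p → u ≡ atomValue p
      atom-of-F = atom-InImage (P' , F≡ζ)

      a≤ : ∀ {u} → (∃ λ p → u ≡ atomValue p) → a ≤ u
      a≤ (left  , refl) = ≤-refl a
      a≤ (right , refl) = a≤b

      ≤b : ∀ {u} → (∃ λ p → u ≡ atomValue p) → u ≤ b
      ≤b (left  , refl) = a≤b
      ≤b (right , refl) = ≤-refl b

      atomic-guaranteed : Atomic F → LeftSideAtom F s → RightSideAtom F t → s ≤ t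
      atomic-guaranteed (inj₁ (l , r , refl)) latom tR =
        subst (_≤ t) (sym (side-ζ-atom left P' (cong (side left) (sym F≡ζ))))
              (a≤ (atom-of-F (rightSideAtom-atom tR)))
      atomic-guaranteed (inj₂ (r , l , refl)) sL ratom =
        subst (s ≤_) (sym (side-ζ-atom right P' (cong (side right) (sym F≡ζ))))
              (≤b (atom-of-F (leftSideAtom-atom sL)))

  module Z = Embedding 0# 0#
  open Z using (ζ[_]; ζ-option; ζ⊕-option⁻; side-ζ-atom)

  mutual
    ζ≡ζ[] : ∀ P → ζ P ≡ ζ[ P ]
    ζ≡ζ[] (np L R) = cong₂ ⟨_∣_⟩ (ζside≡ L) (ζside≡ R)

    ζside≡ : ∀ L → ζside L ≡ Z.embedSide 0# L
    ζside≡ []       = refl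
    ζside≡ (g ∷ gs) = cong opts (ζopts≡ g gs)

    ζopts≡ : ∀ g gs → ζopts g gs ≡ Z.embedOpts g gs
    ζopts≡ g []       = cong [_] (ζ≡ζ[] g)
    ζopts≡ g (h ∷ hs) = cong₂ _∷_ (ζ≡ζ[] g) (ζopts≡ h hs)

  ζ-atom+ : ∀ p {sa} sb → sa ≡ Z.atomValue p → sa + sb ≡ sb
  ζ-atom+ left  sb refl = 0+ sb
  ζ-atom+ right sb refl = 0+ sb

  atom-ζ⊕ : ∀ p P X {s} → side p (ζ[ P ] ⊕ X) ≡ atom s → side p X ≡ atom s
  atom-ζ⊕ p P X e with ⊕-atom p ζ[ P ] X e
  ... | sa , sb , ea , eb , refl =
    subst (λ s → side p X ≡ atom s) (sym (ζ-atom+ p sb (side-ζ-atom p P ea))) eb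

  atoms-ζ⊕ : ∀ P X {s} → AtomOf (ζ[ P ] ⊕ X) s → AtomOf X s
  atoms-ζ⊕ P X at with atoms-⊕ ζ[ P ] X at
  ... | sa , sb , atP , atX , refl with Z.atom-InImage (P , refl) atP
  ...   | p , e = subst (AtomOf X) (sym (ζ-atom+ p sb e)) atX

  leftAtom-≤-Ls : ∀ {X l} → Guaranteed X → side left X ≡ atom l → ∀ P → l ≤ Ls (ζ[ P ] ⊕ X)
  leftAtom-≤-Ls {X} gX e P =
    leftAtom-least gX e (atoms-ζ⊕ P X (Ls-atom (◁-acc (ζ[ P ] ⊕ X))))

  Rs-≤-rightAtom : ∀ {X r} → Guaranteed X → side right X ≡ atom r → ∀ P → Rs (ζ[ P ] ⊕ X) ≤ r
  Rs-≤-rightAtom {X} gX e P =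
    rightAtom-greatest gX e (atoms-ζ⊕ P X (Rs-atom (◁-acc (ζ[ P ] ⊕ X))))

  ζ-monotone : ∀ {G H X} → Acc _⊏⁺_ G → Acc _⊏⁺_ H → Acc _◁_ X → Guaranteed X → G ≤NP H →
               Ls (ζ[ G ] ⊕ X) ≤ Ls (ζ[ H ] ⊕ X) × Rs (ζ[ G ] ⊕ X) ≤ Rs (ζ[ H ] ⊕ X)
  ζ-monotone {G} {H} {X} (acc accG) (acc accH) (acc accX) gX G≤H = Ls-mono , Rs-mono
    where
    X-move : ∀ p {x} → x ∈ options p X →
             Ls (ζ[ G ] ⊕ x) ≤ Ls (ζ[ H ] ⊕ x) × Rs (ζ[ G ] ⊕ x) ≤ Rs (ζ[ H ] ⊕ x)
    X-move p x∈ =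
      ζ-monotone (acc accG) (acc accH) (accX (p , x∈)) (guaranteed-option p gX x∈) G≤H

    leftMove-G : ∀ {g} → g ∈ npOptions left G → Rs (ζ[ g ] ⊕ X) ≤ Ls (ζ[ H ] ⊕ X)
    leftMove-G {g} g∈ with ≤NP-leftOption G≤H g∈
    ... | inj₁ (h' , h'∈ , g≤h') =
      ≤-trans (proj₂ (ζ-monotone (accG [ left , g∈ ]) (accH [ left , h'∈ ]) (acc accX) gX g≤h'))
              (Ls-upper (ζ[ H ] ⊕ X) (⊕-optionˡ left ζ[ H ] X (ζ-option left H h'∈)))
    ... | inj₂ (g' , g'∈ , g'≤H) =
      ≤-trans (Rs-lower (ζ[ g ] ⊕ X) (⊕-optionˡ right ζ[ g ] X (ζ-option right g g'∈)))
              (proj₁ (ζ-monotone (accG ((right , g'∈) ∷ [ left , g∈ ])) (acc accH) (acc accX)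
                                 gX g'≤H))

    Ls-mono : Ls (ζ[ G ] ⊕ X) ≤ Ls (ζ[ H ] ⊕ X)
    Ls-mono = Ls-≤ (ζ[ G ] ⊕ X) (λ e → leftAtom-≤-Ls gX (atom-ζ⊕ left G X e) H) leftMove
      where
      leftMove : ∀ {k} → k ∈ options left (ζ[ G ] ⊕ X) → Rs k ≤ Ls (ζ[ H ] ⊕ X)
      leftMove m with ζ⊕-option⁻ left G X m
      ... | inj₁ (g , g∈ , refl) = leftMove-G g∈
      ... | inj₂ (x , x∈ , refl) =
        ≤-trans (proj₂ (X-move left x∈)) (Ls-upper (ζ[ H ] ⊕ X) (⊕-optionʳ left ζ[ H ] X x∈))

    rightMove-H : ∀ {h} → h ∈ npOptions right H → Rs (ζ[ G ] ⊕ X) ≤ Ls (ζ[ h ] ⊕ X)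
    rightMove-H {h} h∈ with ≤NP-rightOption G≤H h∈
    ... | inj₁ (h' , h'∈ , G≤h') =
      ≤-trans (proj₂ (ζ-monotone (acc accG) (accH ((left , h'∈) ∷ [ right , h∈ ])) (acc accX)
                                 gX G≤h'))
              (Ls-upper (ζ[ h ] ⊕ X) (⊕-optionˡ left ζ[ h ] X (ζ-option left h h'∈)))
    ... | inj₂ (g' , g'∈ , g'≤h) =
      ≤-trans (Rs-lower (ζ[ G ] ⊕ X) (⊕-optionˡ right ζ[ G ] X (ζ-option right G g'∈)))
              (proj₁ (ζ-monotone (accG [ right , g'∈ ]) (accH [ right , h∈ ]) (acc accX) gX g'≤h))

    Rs-mono : Rs (ζ[ G ] ⊕ X) ≤ Rs (ζ[ H ] ⊕ X)
    Rs-mono = ≤-Rs (ζ[ H ] ⊕ X) (λ e → Rs-≤-rightAtom gX (atom-ζ⊕ right H X e) G) rightMove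
      where
      rightMove : ∀ {k} → k ∈ options right (ζ[ H ] ⊕ X) → Rs (ζ[ G ] ⊕ X) ≤ Ls k
      rightMove m with ζ⊕-option⁻ right H X m
      ... | inj₁ (h , h∈ , refl) = rightMove-H h∈
      ... | inj₂ (x , x∈ , refl) =
        ≤-trans (Rs-lower (ζ[ G ] ⊕ X) (⊕-optionʳ right ζ[ G ] X x∈)) (proj₁ (X-move right x∈))

  forward : ∀ {G H} → G ≤NP H → ζ G ≤GS ζ H
  forward {G} {H} G≤H X gX rewrite ζ≡ζ[] G | ζ≡ζ[] H =
    ζ-monotone (⊏⁺-acc G) (⊏⁺-acc H) (◁-acc X) gX G≤H

  -- Order reflection.  w[ K ] is K embedded with Left atoms a and Right atoms b ≠ a,
  -- so that the final atom of ζ[ P ] + w[ K ] records which player got stuck.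
  module Distinguishing (a b : Carrier) (a≤b : a ≤ b) (a≢b : ¬ a ≡ b) where
    module W = Embedding a b
    open W using () renaming (ζ[_] to w[_])

    atom-ζ⊕w : ∀ p P K {s} → side p (ζ[ P ] ⊕ w[ K ]) ≡ atom s → s ≡ W.atomValue p
    atom-ζ⊕w p P K e with ⊕-atom p ζ[ P ] w[ K ] e
    ... | sa , sb , ea , eb , refl = trans (ζ-atom+ p sb (side-ζ-atom p P ea)) (W.side-ζ-atom p K eb)

    ζ⊕w-option⁻ : ∀ p P K {k} → k ∈ options p (ζ[ P ] ⊕ w[ K ]) →
      (∃ λ P' → P' ∈ npOptions p P × k ≡ ζ[ P' ] ⊕ w[ K ]) ⊎
      (∃ λ K' → K' ∈ npOptions p K × k ≡ ζ[ P ] ⊕ w[ K' ])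
    ζ⊕w-option⁻ p P K m with ζ⊕-option⁻ p P w[ K ] m
    ... | inj₁ P-move = inj₁ P-move
    ... | inj₂ (_ , m' , refl) with W.ζ-option⁻ p K m'
    ...   | K' , K'∈ , refl = inj₂ (K' , K'∈ , refl)

    high-score-wins : ∀ {P K} → Acc _⊏_ P → Acc _⊏_ K →
      (b ≤ Rs (ζ[ P ] ⊕ w[ K ]) → LeftWinsSecond (P +NP K)) ×
      (b ≤ Ls (ζ[ P ] ⊕ w[ K ]) → LeftWinsFirst (P +NP K))
    high-score-wins {P@(np _ _)} {K@(np _ _)} (acc accP) (acc accK) = second , first
      where
      second : b ≤ Rs (ζ[ P ] ⊕ w[ K ]) → LeftWinsSecond (P +NP K)
      second b≤ = leftWinsSecond⁺ rightMove
        where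
        rightMove : ∀ {x} → x ∈ npOptions right (P +NP K) → LeftWinsFirst x
        rightMove x∈ with +NP-option⁻ right P K x∈
        ... | inj₁ (p , p∈ , refl) = proj₂ (high-score-wins (accP (right , p∈)) (acc accK))
          (≤-trans b≤ (Rs-lower (ζ[ P ] ⊕ w[ K ])
                        (⊕-optionˡ right ζ[ P ] w[ K ] (Z.ζ-option right P p∈))))
        ... | inj₂ (k , k∈ , refl) = proj₂ (high-score-wins (acc accP) (accK (right , k∈)))
          (≤-trans b≤ (Rs-lower (ζ[ P ] ⊕ w[ K ])
                        (⊕-optionʳ right ζ[ P ] w[ K ] (W.ζ-option right K k∈))))

      first : b ≤ Ls (ζ[ P ] ⊕ w[ K ]) → LeftWinsFirst (P +NP K)
      first b≤ with Ls-cases (ζ[ P ] ⊕ w[ K ])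
      ... | inj₁ e = ⊥-elim (a≢b (≤-antisym a≤b (subst (b ≤_) (atom-ζ⊕w left P K e) b≤)))
      ... | inj₂ (k , m , e) with ζ⊕w-option⁻ left P K m
      ...   | inj₁ (p , p∈ , refl) = leftWinsFirst⁺ (+NP-optionˡ left P K p∈)
              (proj₁ (high-score-wins (accP (left , p∈)) (acc accK)) (subst (b ≤_) e b≤))
      ...   | inj₂ (k' , k'∈ , refl) = leftWinsFirst⁺ (+NP-optionʳ left P K k'∈)
              (proj₁ (high-score-wins (acc accP) (accK (left , k'∈))) (subst (b ≤_) e b≤))

    -- Tweedledum: in ζ[ P ] + w[ -P ] Left copies Right's moves, so Right scores at least b.
    mirror : ∀ {P} → Acc _⊏_ P → b ≤ Rs (ζ[ P ] ⊕ w[ negNP P ])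
    mirror {P} (acc accP) = ≤-Rs (ζ[ P ] ⊕ w[ negNP P ])
      (λ e → subst (b ≤_) (sym (atom-ζ⊕w right P (negNP P) e)) (≤-refl b)) rightMove
      where
      rightMove : ∀ {k} → k ∈ options right (ζ[ P ] ⊕ w[ negNP P ]) → b ≤ Ls k
      rightMove m with ζ⊕w-option⁻ right P (negNP P) m
      ... | inj₁ (p , p∈ , refl) = ≤-trans (mirror (accP (right , p∈)))
        (Ls-upper (ζ[ p ] ⊕ w[ negNP P ])
          (⊕-optionʳ left ζ[ p ] w[ negNP P ] (W.ζ-option left (negNP P) (neg-option left P p∈))))
      ... | inj₂ (_ , q∈ , refl) with neg-option⁻ right P q∈
      ...   | p , p∈ , refl = ≤-trans (mirror (accP (left , p∈)))
        (Ls-upper (ζ[ P ] ⊕ w[ negNP p ])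
          (⊕-optionˡ left ζ[ P ] w[ negNP p ] (Z.ζ-option left P p∈)))

    distinguish : ∀ {G H} → ζ G ≤GS ζ H → G ≤NP H
    distinguish {G} {H} ζG≤ζH
      with proj₂ (ζG≤ζH w[ negNP G ] (W.ζ-guaranteed a≤b (negNP G)))
    ... | Rs≤ rewrite ζ≡ζ[] G | ζ≡ζ[] H =
      proj₁ (high-score-wins (⊏-acc H) (⊏-acc (negNP G))) (≤-trans (mirror (⊏-acc G)) Rs≤)

  backward : ∀ {G H} → ζ G ≤GS ζ H → G ≤NP H
  backward with ≤-total 0# 1#
  ... | inj₁ 0≤1 = Distinguishing.distinguish 0# 1# 0≤1 0≢1
  ... | inj₂ 1≤0 = Distinguishing.distinguish 1# 0# 1≤0 (λ e → 0≢1 (sym e))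

theorem2 : (ℝ : RealNumbers) → (G H : NP) →
    (G ≤NP H) ⇔ Scoring._≤GS_ ℝ (Scoring.ζ ℝ G) (Scoring.ζ ℝ H)
theorem2 ℝ G H = mk⇔ (forward ℝ) (backward ℝ)
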